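{- Let $W_n=K_1+C_{n-1}$ be the wheel graph of order $n\ge 4$ (a cycle on $n-1$ vertices together with one additional vertex adjacent to every vertex of the cycle). Then $\mathrm{edim}_f(W_n)=\frac{n}{2}$ if $n\in\{4,5\}$, and $\mathrm{edim}_f(W_n)=\frac{n-1}{2}$ if $n\ge 6$.
   Context: All graphs are finite, simple, undirected; $d(u,w)$ is the length of a shortest $u$–$w$ path. For a vertex $v$ and an edge $e=xy$, $d(e,v)=\min\{d(x,v),d(y,v)\}$; for distinct edges $e_1,e_2$, $R_e\{e_1,e_2\}=\{v: d(v,e_1)\neq d(v,e_2)\}$. For $g:V\to\mathbb{R}$ and $U\subseteq V$, $g(U)=\sum_{s\in U}g(s)$. A function $g:V(G)\to[0,1]$ is an edge resolving function of $G$ if $g(R_e\{e_1,e_2\})\ge1$ for all distinct edges $e_1,e_2$, and $\mathrm{edim}_f(G)=\min\{g(V(G)): g\text{ an edge resolving function of }G\}$.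
   Formalization: The edge resolving functions g take values in the rationals in [0,1] instead of the reals. -}

module Defs where

open import Data.Bool using (Bool; true; false; _∧_; _∨_; not; if_then_else_; T)
open import Data.Nat as ℕ using (ℕ; zero; suc; _≡ᵇ_; _∸_)
open import Data.Fin using (Fin; toℕ)
open import Data.Fin.Properties using (any?)
open import Data.Integer using (+_)
open import Data.Rational using (ℚ; 0ℚ; 1ℚ; _+_; _≤_; _/_)
open import Data.Product using (Σ; _×_; _,_)
open import Relation.Binary.PropositionalEquality using (_≡_; refl; cong; cong₂)
open import Data.Bool.Properties using (∨-comm)
open import Relation.Nullary using (¬_; does)

record Graph : Set where
  field
    order    : ℕ
    adj      : Fin order → Fin order → Bool
    irrefl   : ∀ u → adj u u ≡ false
    sym      : ∀ u w → adj u w ≡ adj w u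

module _ (G : Graph) where
  open Graph G

  within : ℕ → Fin order → Fin order → Bool
  within zero    u w = does (Data.Fin._≟_ u w)
  within (suc k) u w = within k u w ∨ does (any? (λ v → T? (adj u v ∧ within k v w)))
    where
      open import Relation.Nullary.Decidable using () renaming (T? to T?)

  -- shortest-path distance: least k with a walk of length ≤ k
  -- (search bounded by the order; for connected graphs this is d(u,w))
  dist : Fin order → Fin order → ℕ
  dist u w = go order 0
    where
      go : ℕ → ℕ → ℕ
      go zero    k = k
      go (suc f) k = if within k u w then k else go f (suc k)

  -- an edge is a pair of adjacent vertices (ordered representation)
  Edge : Set
  Edge = Σ (Fin order) λ x → Σ (Fin order) λ y → T (adj x y)

  distEdge : Edge → Fin order → ℕ
  distEdge (x , y , _) v = ℕ._⊓_ (dist x v) (dist y v)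

  DistinctEdges : Edge → Edge → Set
  DistinctEdges (x₁ , y₁ , _) (x₂ , y₂ , _) =
    ¬ (x₁ ≡ x₂ × y₁ ≡ y₂) × ¬ (x₁ ≡ y₂ × y₁ ≡ x₂)

  sumFin : ∀ {m} → (Fin m → ℚ) → ℚ
  sumFin {zero}  f = 0ℚ
  sumFin {suc m} f = f Fin.zero + sumFin (λ i → f (Fin.suc i))
    where import Data.Fin as Fin

  weightR : (Fin order → ℚ) → Edge → Edge → ℚ
  weightR g e₁ e₂ =
    sumFin (λ v → if distEdge e₁ v ≡ᵇ distEdge e₂ v then 0ℚ else g v)

  IsEdgeResolvingFunction : (Fin order → ℚ) → Set
  IsEdgeResolvingFunction g =
    (∀ v → 0ℚ ≤ g v × g v ≤ 1ℚ) ×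
    (∀ e₁ e₂ → DistinctEdges e₁ e₂ → 1ℚ ≤ weightR g e₁ e₂)

  IsFractionalEdgeMetricDimension : ℚ → Set
  IsFractionalEdgeMetricDimension q =
    (Σ (Fin order → ℚ) λ g → IsEdgeResolvingFunction g × sumFin g ≡ q) ×
    (∀ g → IsEdgeResolvingFunction g → q ≤ sumFin g)

-- Wheel W_n = K_1 + C_{n-1}: vertex 0 is the hub, vertices 1,…,n-1 form
-- the cycle 1 - 2 - … - (n-1) - 1.  (The conjunct "a ≠ b" only serves to
-- exclude a loop in the degenerate case n = 2; it changes nothing for n ≥ 4.)
wheelHalf : ℕ → ℕ → ℕ → Bool
wheelHalf n a b =
  ((a ≡ᵇ 0) ∧ not (b ≡ᵇ 0)) ∨
  (not (a ≡ᵇ 0) ∧ not (b ≡ᵇ 0) ∧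
    ((suc a ≡ᵇ b) ∨ ((a ≡ᵇ 1) ∧ (b ≡ᵇ n ∸ 1))))

wheelAdjℕ : ℕ → ℕ → ℕ → Bool
wheelAdjℕ n a b = not (a ≡ᵇ b) ∧ (wheelHalf n a b ∨ wheelHalf n b a)

≡ᵇ-refl : ∀ a → (a ≡ᵇ a) ≡ true
≡ᵇ-refl zero    = refl
≡ᵇ-refl (suc a) = ≡ᵇ-refl a

≡ᵇ-sym : ∀ a b → (a ≡ᵇ b) ≡ (b ≡ᵇ a)
≡ᵇ-sym zero    zero    = refl
≡ᵇ-sym zero    (suc b) = refl
≡ᵇ-sym (suc a) zero    = refl
≡ᵇ-sym (suc a) (suc b) = ≡ᵇ-sym a b

wheel : ℕ → Graph
wheel n = record
  { order  = n
  ; adj    = λ u w → wheelAdjℕ n (toℕ u) (toℕ w)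
  ; irrefl = λ u → cong (λ t → not t ∧ (wheelHalf n (toℕ u) (toℕ u) ∨ wheelHalf n (toℕ u) (toℕ u))) (≡ᵇ-refl (toℕ u))
  ; sym    = λ u w → cong₂ _∧_ (cong not (≡ᵇ-sym (toℕ u) (toℕ w)))
                        (∨-comm (wheelHalf n (toℕ u) (toℕ w)) (wheelHalf n (toℕ w) (toℕ u)))
  }

{-# OPTIONS --safe #-}
-- For distinct rim vertices u and w, the spokes hub–u and hub–w are at the same distance from every
-- other vertex, so an edge resolving function g has g(u) + g(w) ≥ 1; adding these inequalities over
-- the consecutive pairs of the rim cycle gives g(V) ≥ (n − 1)/2. When n ≤ 5 the hub also forms such a
-- pair with the rim vertices 1 and n − 1, and the cycle hub, 1, …, n − 1 gives g(V) ≥ n/2.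
-- Conversely, an endpoint of e₁ not on e₂ has distance 0 to e₁ and positive distance to e₂, so the
-- constant ½ is edge resolving. For n ≥ 6 the hub may even get weight 0: if it is an endpoint of e₁
-- only, the rim edge e₂ has a rim vertex at distance 2 from it, whereas every vertex is within
-- distance 1 of e₁.
module Submission where

open import Defs
open import Data.Bool using (true; false; T; _∧_; _∨_; if_then_else_)
open import Data.Bool.Properties using (T-∧; T-∨; T-≡; ∨-zeroʳ; if-cong)
open import Data.Nat as ℕ using (ℕ; zero; suc; _≡ᵇ_; _∸_; _⊓_; z≤n; s≤s)
open import Data.Nat.Properties as ℕP using (≡⇒≡ᵇ; ⊓-glb; m⊓n≤m; m⊓n≤n; <⇒≢)
open import Data.Fin using (Fin; zero; suc; toℕ; fromℕ; fromℕ<; inject₁; _≟_; #_)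
open import Data.Fin.Properties using (any?; all?; suc-injective; toℕ<n; toℕ-fromℕ<)
open import Data.Integer as ℤ using (+_)
open import Data.Rational using (ℚ; toℚᵘ; 0ℚ; 1ℚ; ½; _+_; _≤_; _/_; _≤?_)
open import Data.Rational.Properties as ℚP
  using (≤-refl; ≤-trans; +-mono-≤; +-monoˡ-≤; +-identityˡ; +-identityʳ; +-comm)
import Data.Rational.Unnormalised as ℚᵘ
import Data.Rational.Unnormalised.Properties as ℚᵘP
import Data.Rational.Solver as ℚ-Solver
import Data.Integer.Solver as ℤ-Solver
open import Algebra.Properties.CommutativeMonoid.Sum ℚP.+-0-commutativeMonoid
  using (sum; ∑-distrib-+; sum-init-last)
open import Data.Product using (Σ-syntax; _×_; _,_; proj₁; proj₂)
open import Data.Sum using (_⊎_; inj₁; inj₂; [_,_]) renaming (map to ⊎-map)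
open import Data.Empty using (⊥)
open import Data.Unit using (tt)
open import Function using (_∘_)
open import Function.Bundles using (Equivalence)
open import Relation.Nullary using (¬_; Dec; yes; no; does; contradiction)
open import Relation.Nullary.Decidable using (T?; True; toWitness; dec-true; dec-false; ¬?; _→-dec_; from-yes)
open import Relation.Binary.PropositionalEquality hiding ([_])

open Equivalence using (to; from)

half-suc : ∀ a → (+ suc a) / 2 ≡ ½ + (+ a) / 2
half-suc a = ℚP.toℚᵘ-injective (begin
  toℚᵘ ((+ suc a) / 2)                  ≈⟨ ℚP.toℚᵘ-fromℚᵘ (half (+ suc a)) ⟩
  half (+ suc a)                        ≈⟨ ℚᵘ.*≡* (split (+ a)) ⟩
  half (+ 1) ℚᵘ.+ half (+ a)            ≈⟨ ℚᵘP.+-cong (ℚᵘP.≃-sym (ℚP.toℚᵘ-fromℚᵘ (half (+ 1))))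
                                                       (ℚᵘP.≃-sym (ℚP.toℚᵘ-fromℚᵘ (half (+ a)))) ⟩
  toℚᵘ ½ ℚᵘ.+ toℚᵘ ((+ a) / 2)          ≈⟨ ℚᵘP.≃-sym (ℚP.toℚᵘ-homo-+ ½ ((+ a) / 2)) ⟩
  toℚᵘ (½ + (+ a) / 2)                  ∎)
  where
  open ℚᵘP.≃-Reasoning
  open ℤ-Solver.+-*-Solver
  -- half i is i / 2: mkℚᵘ takes the denominator minus one.
  half : ℤ.ℤ → ℚᵘ.ℚᵘ
  half i = ℚᵘ.mkℚᵘ i 1
  split : ∀ x → ((+ 1) ℤ.+ x) ℤ.* ((+ 2) ℤ.* (+ 2)) ≡ ((+ 1) ℤ.* (+ 2) ℤ.+ x ℤ.* (+ 2)) ℤ.* (+ 2)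
  split = solve 1 (λ x → (con (+ 1) :+ x) :* (con (+ 2) :* con (+ 2))
                      := (con (+ 1) :* con (+ 2) :+ x :* con (+ 2)) :* con (+ 2)) refl

p+p≤q+q⇒p≤q : ∀ p q → p + p ≤ q + q → p ≤ q
p+p≤q+q⇒p≤q p q p+p≤q+q with p ≤? q
... | yes p≤q = p≤q
... | no p≰q = contradiction (ℚP.≤-<-trans p+p≤q+q (ℚP.+-mono-< q<p q<p)) (ℚP.<-irrefl refl)
  where q<p = ℚP.≰⇒> p≰q

0≤q⇒p≤q+p : ∀ {p q} → 0ℚ ≤ q → p ≤ q + p
0≤q⇒p≤q+p {p} {q} 0≤q = subst (_≤ q + p) (+-identityˡ p) (+-monoˡ-≤ p 0≤q)

0≤½ : 0ℚ ≤ ½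
0≤½ = from-yes (0ℚ ≤? ½)

½≤1 : ½ ≤ 1ℚ
½≤1 = from-yes (½ ≤? 1ℚ)

module GraphProperties (G : Graph) where
  open Graph G using (order; adj; irrefl)

  within-adjacent : ∀ u w → T (adj u w) → within G 1 u w ≡ true
  within-adjacent u w u~w = trans
    (cong (does (u ≟ w) ∨_) (dec-true (any? _) (w , from T-∧ (u~w , from T-≡ (dec-true (w ≟ w) refl)))))
    (∨-zeroʳ _)

  within-nonadjacent : ∀ u w → u ≢ w → adj u w ≡ false → within G 1 u w ≡ false
  within-nonadjacent u w u≢w u≁w rewrite dec-false (u ≟ w) u≢w =
    dec-false (any? _) λ (v , step) → no-step v (to T-∧ step)
    where
    no-step : ∀ v → T (adj u v) × T (does (v ≟ w)) → ⊥
    no-step v (u~v , v≡w) with v ≟ w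
    ... | yes refl = subst T u≁w u~v
    ... | no _     = v≡w

  adjacent⇒≢ : ∀ {x y} → T (adj x y) → x ≢ y
  adjacent⇒≢ {x} x~x refl = subst T (irrefl x) x~x

  infix 4 _∈ₑ_ _∉ₑ_

  _∈ₑ_ : Fin order → Edge G → Set
  v ∈ₑ (x , y , _) = v ≡ x ⊎ v ≡ y

  _∉ₑ_ : Fin order → Edge G → Set
  v ∉ₑ e = ¬ v ∈ₑ e

  private-endpoint : ∀ e₁ e₂ → DistinctEdges G e₁ e₂ → Σ[ u ∈ Fin order ] u ∈ₑ e₁ × u ∉ₑ e₂
  private-endpoint (x₁ , y₁ , x₁~y₁) (x₂ , y₂ , _) (≢same , ≢flipped) with x₁ ≟ x₂ | x₁ ≟ y₂
  ... | yes refl | _ = y₁ , inj₂ refl , λ where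
    (inj₁ refl) → adjacent⇒≢ x₁~y₁ refl
    (inj₂ y₁≡y₂) → ≢same (refl , y₁≡y₂)
  ... | no _ | yes refl = y₁ , inj₂ refl , λ where
    (inj₁ y₁≡x₂) → ≢flipped (refl , y₁≡x₂)
    (inj₂ refl) → adjacent⇒≢ x₁~y₁ refl
  ... | no x₁≢x₂ | no x₁≢y₂ = x₁ , inj₁ refl , λ where
    (inj₁ x₁≡x₂) → x₁≢x₂ x₁≡x₂
    (inj₂ x₁≡y₂) → x₁≢y₂ x₁≡y₂

  distinctEdges-sym : ∀ {e₁ e₂} → DistinctEdges G e₁ e₂ → DistinctEdges G e₂ e₁
  distinctEdges-sym (≢same , ≢flipped) =
    (λ (x≡ , y≡) → ≢same (sym x≡ , sym y≡)) , (λ (x≡ , y≡) → ≢flipped (sym y≡ , sym x≡))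

  Resolves : Edge G → Edge G → Fin order → Set
  Resolves e₁ e₂ v = distEdge G e₁ v ≢ distEdge G e₂ v

  OnlyResolvedBy : Fin order → Fin order → Edge G → Edge G → Set
  OnlyResolvedBy a b e₁ e₂ = ∀ v → v ≢ a → v ≢ b → distEdge G e₁ v ≡ distEdge G e₂ v

  onlyResolvedBy? : ∀ a b e₁ e₂ → Dec (OnlyResolvedBy a b e₁ e₂)
  onlyResolvedBy? a b e₁ e₂ =
    all? λ v → ¬? (v ≟ a) →-dec ¬? (v ≟ b) →-dec distEdge G e₁ v ℕ.≟ distEdge G e₂ v

  -- sumFin and weightR take a graph argument that they never use, so sums are taken relative to G.

  sumFin≡sum : ∀ {m} (f : Fin m → ℚ) → sumFin G f ≡ sum f
  sumFin≡sum {zero}  f = refl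
  sumFin≡sum {suc m} f = cong (_+_ (f zero)) (sumFin≡sum (f ∘ suc))

  sumFin-+ : ∀ {m} (f g : Fin m → ℚ) → sumFin G (λ i → f i + g i) ≡ sumFin G f + sumFin G g
  sumFin-+ f g = begin
    sumFin G (λ i → f i + g i) ≡⟨ sumFin≡sum (λ i → f i + g i) ⟩
    sum (λ i → f i + g i)      ≡⟨ ∑-distrib-+ f g ⟩
    sum f + sum g              ≡⟨ cong₂ _+_ (sumFin≡sum f) (sumFin≡sum g) ⟨
    sumFin G f + sumFin G g    ∎
    where open ≡-Reasoning

  sumFin-init-last : ∀ {m} (f : Fin (suc m) → ℚ) → sumFin G f ≡ sumFin G (f ∘ inject₁) + f (fromℕ m)
  sumFin-init-last f = begin
    sumFin G f                            ≡⟨ sumFin≡sum f ⟩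
    sum f                                 ≡⟨ sum-init-last f ⟩
    sum (f ∘ inject₁) + f _               ≡⟨ cong (_+ _) (sumFin≡sum (f ∘ inject₁)) ⟨
    sumFin G (f ∘ inject₁) + f _          ∎
    where open ≡-Reasoning

  sumFin-mono : ∀ {m} {f g : Fin m → ℚ} → (∀ i → f i ≤ g i) → sumFin G f ≤ sumFin G g
  sumFin-mono {zero}  f≤g = ≤-refl
  sumFin-mono {suc m} f≤g = +-mono-≤ (f≤g zero) (sumFin-mono (f≤g ∘ suc))

  sumFin-½ : ∀ m → sumFin G {m} (λ _ → ½) ≡ (+ m) / 2
  sumFin-½ zero    = refl
  sumFin-½ (suc m) = trans (cong (_+_ ½) (sumFin-½ m)) (sym (half-suc m))

  sumFin-vanishing : ∀ {m} (f : Fin m → ℚ) → (∀ v → f v ≡ 0ℚ) → sumFin G f ≡ 0ℚ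
  sumFin-vanishing {zero}  f f≡0 = refl
  sumFin-vanishing {suc m} f f≡0 = cong₂ _+_ (f≡0 zero) (sumFin-vanishing (f ∘ suc) (f≡0 ∘ suc))

  sumFin-single : ∀ {m} (f : Fin m → ℚ) u → (∀ v → v ≢ u → f v ≡ 0ℚ) → sumFin G f ≡ f u
  sumFin-single {suc m} f zero    f≡0 =
    trans (cong (_+_ (f zero)) (sumFin-vanishing (f ∘ suc) λ v → f≡0 (suc v) λ ())) (+-identityʳ (f zero))
  sumFin-single {suc m} f (suc u) f≡0 =
    trans (cong₂ _+_ (f≡0 zero λ ()) (sumFin-single (f ∘ suc) u λ v v≢u → f≡0 (suc v) (v≢u ∘ suc-injective)))
          (+-identityˡ (f (suc u)))

  sumFin-pair : ∀ {m} (f : Fin m → ℚ) u w → u ≢ w → (∀ v → v ≢ u → v ≢ w → f v ≡ 0ℚ) →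
                sumFin G f ≡ f u + f w
  sumFin-pair {suc m} f zero    zero    u≢w f≡0 = contradiction refl u≢w
  sumFin-pair {suc m} f zero    (suc w) u≢w f≡0 =
    cong (_+_ (f zero)) (sumFin-single (f ∘ suc) w λ v v≢w → f≡0 (suc v) (λ ()) (v≢w ∘ suc-injective))
  sumFin-pair {suc m} f (suc u) zero    u≢w f≡0 =
    trans (cong (_+_ (f zero)) (sumFin-single (f ∘ suc) u λ v v≢u → f≡0 (suc v) (v≢u ∘ suc-injective) (λ ())))
          (+-comm (f zero) (f (suc u)))
  sumFin-pair {suc m} f (suc u) (suc w) u≢w f≡0 =
    trans (cong₂ _+_ (f≡0 zero (λ ()) (λ ())) (sumFin-pair (f ∘ suc) u w (u≢w ∘ cong suc)
            λ v v≢u v≢w → f≡0 (suc v) (v≢u ∘ suc-injective) (v≢w ∘ suc-injective)))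
          (+-identityˡ _)

  sumFin-≥-pair : ∀ {m} (f : Fin m → ℚ) u w → u ≢ w → (∀ v → 0ℚ ≤ f v) → f u + f w ≤ sumFin G f
  sumFin-≥-pair f u w u≢w 0≤f = subst (_≤ sumFin G f)
    (trans (sumFin-pair f|uw u w u≢w f|uw-vanishing) (cong₂ _+_ f|uw-u f|uw-w))
    (sumFin-mono f|uw≤f)
    where
    f|uw : _ → ℚ
    f|uw v = if does (v ≟ u) ∨ does (v ≟ w) then f v else 0ℚ
    f|uw-u : f|uw u ≡ f u
    f|uw-u rewrite dec-true (u ≟ u) refl = refl
    f|uw-w : f|uw w ≡ f w
    f|uw-w rewrite dec-true (w ≟ w) refl | ∨-zeroʳ (does (w ≟ u)) = refl
    f|uw-vanishing : ∀ v → v ≢ u → v ≢ w → f|uw v ≡ 0ℚ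
    f|uw-vanishing v v≢u v≢w rewrite dec-false (v ≟ u) v≢u | dec-false (v ≟ w) v≢w = refl
    f|uw≤f : ∀ v → f|uw v ≤ f v
    f|uw≤f v with does (v ≟ u) ∨ does (v ≟ w)
    ... | true  = ≤-refl
    ... | false = 0≤f v

  -- Over the m + 1 consecutive pairs of the cycle, every vertex is counted twice.
  ½-cycle-bound : ∀ m (h : Fin (suc m) → ℚ) →
    (∀ i → 1ℚ ≤ h (inject₁ i) + h (suc i)) → 1ℚ ≤ h (fromℕ m) + h zero →
    sumFin G {suc m} (λ _ → ½) ≤ sumFin G h
  ½-cycle-bound m h steps closing = p+p≤q+q⇒p≤q (sumFin G {suc m} (λ _ → ½)) (sumFin G h) (begin
    sumFin G {suc m} (λ _ → ½) + sumFin G {suc m} (λ _ → ½)    ≡⟨ sumFin-+ {suc m} (λ _ → ½) (λ _ → ½) ⟨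
    1ℚ + sumFin G {m} (λ _ → 1ℚ)                                ≤⟨ +-mono-≤ closing (sumFin-mono steps) ⟩
    (hₗ + h₀) + sumFin G (λ i → h (inject₁ i) + h (suc i))      ≡⟨ cong (_+_ (hₗ + h₀)) (sumFin-+ (h ∘ inject₁) (h ∘ suc)) ⟩
    (hₗ + h₀) + (sumFin G (h ∘ inject₁) + sumFin G (h ∘ suc))   ≡⟨ regroup hₗ h₀ (sumFin G (h ∘ inject₁)) (sumFin G (h ∘ suc)) ⟩
    (sumFin G (h ∘ inject₁) + hₗ) + (h₀ + sumFin G (h ∘ suc))   ≡⟨ cong (_+ (h₀ + sumFin G (h ∘ suc))) (sumFin-init-last h) ⟨
    sumFin G h + sumFin G h                                     ∎)
    where
    open ℚP.≤-Reasoning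
    open ℚ-Solver.+-*-Solver
    hₗ = h (fromℕ m)
    h₀ = h zero
    regroup : ∀ a b c d → (a + b) + (c + d) ≡ (c + a) + (b + d)
    regroup = solve 4 (λ a b c d → (a :+ b) :+ (c :+ d) := (c :+ a) :+ (b :+ d)) refl

  -- weightR G g e₁ e₂ unfolds to sumFin G (resolvedWeight g e₁ e₂).
  resolvedWeight : (Fin order → ℚ) → Edge G → Edge G → Fin order → ℚ
  resolvedWeight g e₁ e₂ v = if distEdge G e₁ v ≡ᵇ distEdge G e₂ v then 0ℚ else g v

  resolvedWeight-resolving : ∀ g e₁ e₂ v → Resolves e₁ e₂ v → resolvedWeight g e₁ e₂ v ≡ g v
  resolvedWeight-resolving g e₁ e₂ v resolves = if-cong (dec-false (distEdge G e₁ v ℕ.≟ distEdge G e₂ v) resolves)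

  resolvedWeight-nonresolving : ∀ g e₁ e₂ v → distEdge G e₁ v ≡ distEdge G e₂ v → resolvedWeight g e₁ e₂ v ≡ 0ℚ
  resolvedWeight-nonresolving g e₁ e₂ v eq = if-cong (to T-≡ (≡⇒≡ᵇ _ _ eq))

  resolvedWeight-≤ : ∀ g e₁ e₂ v → 0ℚ ≤ g v → resolvedWeight g e₁ e₂ v ≤ g v
  resolvedWeight-≤ g e₁ e₂ v 0≤gv with distEdge G e₁ v ≡ᵇ distEdge G e₂ v
  ... | true  = 0≤gv
  ... | false = ≤-refl

  resolvedWeight-nonneg : ∀ g e₁ e₂ v → 0ℚ ≤ g v → 0ℚ ≤ resolvedWeight g e₁ e₂ v
  resolvedWeight-nonneg g e₁ e₂ v 0≤gv with distEdge G e₁ v ≡ᵇ distEdge G e₂ v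
  ... | true  = ≤-refl
  ... | false = 0≤gv

  weightR-≤-pair : ∀ g e₁ e₂ {a b} → a ≢ b → (∀ v → 0ℚ ≤ g v) → OnlyResolvedBy a b e₁ e₂ →
                   weightR G g e₁ e₂ ≤ g a + g b
  weightR-≤-pair g e₁ e₂ {a} {b} a≢b 0≤g only = subst (_≤ g a + g b)
    (sym (sumFin-pair (resolvedWeight g e₁ e₂) a b a≢b λ v v≢a v≢b → resolvedWeight-nonresolving g e₁ e₂ v (only v v≢a v≢b)))
    (+-mono-≤ (resolvedWeight-≤ g e₁ e₂ a (0≤g a)) (resolvedWeight-≤ g e₁ e₂ b (0≤g b)))

  weightR-≥-pair : ∀ g e₁ e₂ {a b} → a ≢ b → (∀ v → 0ℚ ≤ g v) → Resolves e₁ e₂ a → Resolves e₁ e₂ b →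
                   g a + g b ≤ weightR G g e₁ e₂
  weightR-≥-pair g e₁ e₂ {a} {b} a≢b 0≤g res-a res-b = subst (_≤ weightR G g e₁ e₂)
    (cong₂ _+_ (resolvedWeight-resolving g e₁ e₂ a res-a) (resolvedWeight-resolving g e₁ e₂ b res-b))
    (sumFin-≥-pair (resolvedWeight g e₁ e₂) a b a≢b λ v → resolvedWeight-nonneg g e₁ e₂ v (0≤g v))

  onlyResolvedBy⇒pair-≥1 : ∀ {g} → IsEdgeResolvingFunction G g → ∀ e₁ e₂ → DistinctEdges G e₁ e₂ →
               ∀ {a b} → a ≢ b → OnlyResolvedBy a b e₁ e₂ → 1ℚ ≤ g a + g b
  onlyResolvedBy⇒pair-≥1 {g} (bounds , resolving) e₁ e₂ e₁≢e₂ a≢b only =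
    ≤-trans (resolving e₁ e₂ e₁≢e₂) (weightR-≤-pair g e₁ e₂ a≢b (proj₁ ∘ bounds) only)

  pair-≥1-by-decision : ∀ {g} → IsEdgeResolvingFunction G g → ∀ e₁ e₂ → DistinctEdges G e₁ e₂ →
                       ∀ a b → a ≢ b → {True (onlyResolvedBy? a b e₁ e₂)} → 1ℚ ≤ g a + g b
  pair-≥1-by-decision ρ e₁ e₂ e₁≢e₂ a b a≢b {only} = onlyResolvedBy⇒pair-≥1 ρ e₁ e₂ e₁≢e₂ a≢b (toWitness only)

  ½-resolvers⇒1≤weightR : ∀ g e₁ e₂ {a b} → a ≢ b → (∀ v → 0ℚ ≤ g v) → g a ≡ ½ → g b ≡ ½ →
                 Resolves e₁ e₂ a → Resolves e₁ e₂ b → 1ℚ ≤ weightR G g e₁ e₂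
  ½-resolvers⇒1≤weightR g e₁ e₂ a≢b 0≤g ga≡½ gb≡½ res-a res-b =
    subst (_≤ weightR G g e₁ e₂) (cong₂ _+_ ga≡½ gb≡½) (weightR-≥-pair g e₁ e₂ a≢b 0≤g res-a res-b)

  PrivateEndpoints : Edge G → Edge G → Fin order → Fin order → Set
  PrivateEndpoints e₁ e₂ u w = u ∈ₑ e₁ × u ∉ₑ e₂ × w ∈ₑ e₂ × w ∉ₑ e₁

  resolving-by-private-endpoints : ∀ g →
    (∀ e₁ e₂ u w → PrivateEndpoints e₁ e₂ u w → 1ℚ ≤ weightR G g e₁ e₂) →
    ∀ e₁ e₂ → DistinctEdges G e₁ e₂ → 1ℚ ≤ weightR G g e₁ e₂
  resolving-by-private-endpoints g bound e₁ e₂ e₁≢e₂ = combine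
    (private-endpoint e₁ e₂ e₁≢e₂) (private-endpoint e₂ e₁ (distinctEdges-sym {e₁} {e₂} e₁≢e₂))
    where
    combine : Σ[ u ∈ Fin order ] u ∈ₑ e₁ × u ∉ₑ e₂ → Σ[ w ∈ Fin order ] w ∈ₑ e₂ × w ∉ₑ e₁ →
              1ℚ ≤ weightR G g e₁ e₂
    combine (u , u∈e₁ , u∉e₂) (w , w∈e₂ , w∉e₁) = bound e₁ e₂ u w (u∈e₁ , u∉e₂ , w∈e₂ , w∉e₁)

inject₁≢suc : ∀ {m} (i : Fin m) → inject₁ i ≢ suc i
inject₁≢suc zero    ()
inject₁≢suc (suc i) eq = inject₁≢suc i (suc-injective eq)

module Wheel (k : ℕ) where
  W : Graph
  W = wheel (4 ℕ.+ k)

  open Graph W using (adj)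
  open GraphProperties W public

  hub : Fin (4 ℕ.+ k)
  hub = zero

  within-1-hub : ∀ w → within W 1 hub w ≡ true
  within-1-hub zero    = refl
  within-1-hub (suc w) = within-adjacent hub (suc w) tt

  within-2 : ∀ u w → within W 2 u w ≡ true
  within-2 zero    w rewrite within-1-hub w = refl
  within-2 (suc u) w = trans
    (cong (within W 1 (suc u) w ∨_)
      (dec-true (any? λ v → T? (adj (suc u) v ∧ within W 1 v w)) (hub , from T-∧ (tt , from T-≡ (within-1-hub w)))))
    (∨-zeroʳ _)

  dist-refl : ∀ u → dist W u u ≡ 0
  dist-refl u = if-cong (dec-true (u ≟ u) refl)

  dist-adjacent : ∀ {u w} → u ≢ w → T (adj u w) → dist W u w ≡ 1
  dist-adjacent {u} {w} u≢w u~w =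
    trans (if-cong (dec-false (u ≟ w) u≢w)) (if-cong (within-adjacent u w u~w))

  dist-nonadjacent : ∀ {u w} → u ≢ w → adj u w ≡ false → dist W u w ≡ 2
  dist-nonadjacent {u} {w} u≢w u≁w =
    trans (if-cong (dec-false (u ≟ w) u≢w))
      (trans (if-cong (within-nonadjacent u w u≢w u≁w)) (if-cong (within-2 u w)))

  dist-pos : ∀ {u w} → u ≢ w → 0 ℕ.< dist W u w
  dist-pos {u} {w} u≢w with adj u w in u~w
  ... | true  = subst (0 ℕ.<_) (sym (dist-adjacent u≢w (from T-≡ u~w))) (s≤s z≤n)
  ... | false = subst (0 ℕ.<_) (sym (dist-nonadjacent u≢w u~w)) (s≤s z≤n)

  dist-hub-≤1 : ∀ v → dist W hub v ℕ.≤ 1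
  dist-hub-≤1 zero    = z≤n
  dist-hub-≤1 (suc v) = ℕP.≤-reflexive (dist-adjacent {hub} {suc v} (λ ()) tt)

  distEdge-∈ : ∀ {e v} → v ∈ₑ e → distEdge W e v ≡ 0
  distEdge-∈ {x , y , _} (inj₁ refl) = cong (_⊓ dist W y x) (dist-refl x)
  distEdge-∈ {x , y , _} (inj₂ refl) = trans (cong (dist W x y ⊓_) (dist-refl y)) (ℕP.⊓-zeroʳ _)

  distEdge-∉ : ∀ {e v} → v ∉ₑ e → 0 ℕ.< distEdge W e v
  distEdge-∉ {x , y , _} v∉e = ⊓-glb (dist-pos (v∉e ∘ inj₁ ∘ sym)) (dist-pos (v∉e ∘ inj₂ ∘ sym))

  distEdge-≤1 : ∀ {e} v → hub ∈ₑ e → distEdge W e v ℕ.≤ 1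
  distEdge-≤1 {x , y , _} v (inj₁ refl) = ℕP.≤-trans (m⊓n≤m _ _) (dist-hub-≤1 v)
  distEdge-≤1 {x , y , _} v (inj₂ refl) = ℕP.≤-trans (m⊓n≤n _ _) (dist-hub-≤1 v)

  distEdge-spoke : ∀ {e v} → hub ∈ₑ e → v ∉ₑ e → distEdge W e v ≡ 1
  distEdge-spoke {e} {v} hub∈e v∉e = ℕP.≤-antisym (distEdge-≤1 {e} v hub∈e) (distEdge-∉ {e} v∉e)

  resolves-private : ∀ {e₁ e₂ v} → v ∈ₑ e₁ → v ∉ₑ e₂ → Resolves e₁ e₂ v
  resolves-private {e₁} {e₂} v∈e₁ v∉e₂ eq = <⇒≢ (distEdge-∉ {e₂} v∉e₂) (trans (sym (distEdge-∈ {e₁} v∈e₁)) eq)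

  uniform-½-resolving : IsEdgeResolvingFunction W (λ _ → ½)
  uniform-½-resolving = (λ _ → 0≤½ , ½≤1) , resolving-by-private-endpoints (λ _ → ½) bound
    where
    bound : ∀ e₁ e₂ u w → PrivateEndpoints e₁ e₂ u w → 1ℚ ≤ weightR W (λ _ → ½) e₁ e₂
    bound e₁ e₂ u w (u∈e₁ , u∉e₂ , w∈e₂ , w∉e₁) =
      ½-resolvers⇒1≤weightR (λ _ → ½) e₁ e₂ {u} {w} (λ { refl → w∉e₁ u∈e₁ }) (λ _ → 0≤½) refl refl
        (resolves-private {e₁} {e₂} u∈e₁ u∉e₂) (≢-sym (resolves-private {e₂} {e₁} w∈e₂ w∉e₁))

  spoke : Fin (3 ℕ.+ k) → Edge W
  spoke u = hub , suc u , tt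

  spokes-onlyResolvedBy-rims : ∀ {u w} → u ≢ w → OnlyResolvedBy (suc u) (suc w) (spoke u) (spoke w)
  spokes-onlyResolvedBy-rims u≢w zero    _   _   = refl
  spokes-onlyResolvedBy-rims u≢w (suc v) v≢u v≢w =
    trans (distEdge-spoke {spoke _} (inj₁ refl) [ (λ ()) , v≢u ]) (sym (distEdge-spoke {spoke _} (inj₁ refl) [ (λ ()) , v≢w ]))

  rim-pair-≥1 : ∀ {g} → IsEdgeResolvingFunction W g → ∀ {u w} → u ≢ w → 1ℚ ≤ g (suc u) + g (suc w)
  rim-pair-≥1 ρ {u} {w} u≢w = onlyResolvedBy⇒pair-≥1 ρ (spoke u) (spoke w)
    ((λ (_ , eq) → u≢w (suc-injective eq)) , (λ { (() , _) }))
    (u≢w ∘ suc-injective) (spokes-onlyResolvedBy-rims u≢w)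

  rim-½-bound : ∀ {g} → IsEdgeResolvingFunction W g → sumFin W {3 ℕ.+ k} (λ _ → ½) ≤ sumFin W g
  rim-½-bound {g} ρ = ≤-trans
    (½-cycle-bound (2 ℕ.+ k) (g ∘ suc) (λ i → rim-pair-≥1 ρ (inject₁≢suc i)) (rim-pair-≥1 ρ λ ()))
    (0≤q⇒p≤q+p (proj₁ (proj₁ ρ hub)))

  full-½-bound : ∀ {g} → IsEdgeResolvingFunction W g →
    1ℚ ≤ g hub + g (suc zero) → 1ℚ ≤ g (fromℕ (3 ℕ.+ k)) + g hub →
    sumFin W {4 ℕ.+ k} (λ _ → ½) ≤ sumFin W g
  full-½-bound {g} ρ first closing = ½-cycle-bound (3 ℕ.+ k) g steps closing
    where
    steps : ∀ i → 1ℚ ≤ g (inject₁ i) + g (suc i)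
    steps zero    = first
    steps (suc i) = rim-pair-≥1 ρ (inject₁≢suc i)

-- With at most four rim vertices, every rim vertex is adjacent to one of two consecutive ones; the
-- pairs below are then checked by evaluating onlyResolvedBy?.
small-wheel-hub-pairs : ∀ k → k ℕ.≤ 1 → ∀ {g} → IsEdgeResolvingFunction (Wheel.W k) g →
  1ℚ ≤ g zero + g (suc zero) × 1ℚ ≤ g (fromℕ (3 ℕ.+ k)) + g zero
small-wheel-hub-pairs 0 _ ρ =
    pair-≥1-by-decision ρ (# 0 , # 2 , _) (# 1 , # 2 , _) ((λ ()) , (λ ())) (# 0) (# 1) (λ ())
  , pair-≥1-by-decision ρ (# 0 , # 2 , _) (# 2 , # 3 , _) ((λ ()) , (λ ())) (# 3) (# 0) (λ ())
  where open Wheel 0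
small-wheel-hub-pairs 1 _ ρ =
    pair-≥1-by-decision ρ (# 0 , # 2 , _) (# 1 , # 2 , _) ((λ ()) , (λ ())) (# 0) (# 1) (λ ())
  , pair-≥1-by-decision ρ (# 0 , # 3 , _) (# 3 , # 4 , _) ((λ ()) , (λ ())) (# 4) (# 0) (λ ())
  where open Wheel 1
small-wheel-hub-pairs (suc (suc k)) (s≤s ()) ρ

-- Rim position a stands for vertex a + 1 of the wheel of order M + 2; the rim cycle consists of
-- the steps a → a + 1 and the wrap-around step 0 → M.
RimStep : ℕ → ℕ → ℕ → Set
RimStep M a b = suc a ≡ b ⊎ (a ≡ 0 × b ≡ M)

NotNear : ℕ → ℕ → ℕ → Set
NotNear M a c = a ≢ c × suc a ≢ c × suc c ≢ a × (a ≡ 0 → c ≢ M) × (c ≡ 0 → a ≢ M)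

rim-adjacent⇒step : ∀ M a b → T (wheelAdjℕ (2 ℕ.+ M) (suc a) (suc b)) → RimStep M a b ⊎ RimStep M b a
rim-adjacent⇒step M a b a~b = ⊎-map (step a b) (step b a) (to T-∨ (proj₂ (to T-∧ a~b)))
  where
  step : ∀ a b → T ((suc a ≡ᵇ b) ∨ ((a ≡ᵇ 0) ∧ (b ≡ᵇ M))) → RimStep M a b
  step a b a→b with to T-∨ a→b
  ... | inj₁ a+1≡b = inj₁ (ℕP.≡ᵇ⇒≡ (suc a) b a+1≡b)
  ... | inj₂ wrap with to T-∧ wrap
  ... | a≡0 , b≡M = inj₂ (ℕP.≡ᵇ⇒≡ a 0 a≡0 , ℕP.≡ᵇ⇒≡ b M b≡M)

≢⇒≡ᵇ-false : ∀ {m n} → m ≢ n → (m ≡ᵇ n) ≡ false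
≢⇒≡ᵇ-false {m} {n} = dec-false (m ℕ.≟ n)

no-wrap : ∀ M a c → (a ≡ 0 → c ≢ M) → ((a ≡ᵇ 0) ∧ (c ≡ᵇ M)) ≡ false
no-wrap M zero    c c≢M = ≢⇒≡ᵇ-false (c≢M refl)
no-wrap M (suc a) c _   = refl

notNear⇒nonadjacent : ∀ M a c → NotNear M a c → wheelAdjℕ (2 ℕ.+ M) (suc a) (suc c) ≡ false
notNear⇒nonadjacent M a c (a≢c , a+1≢c , c+1≢a , a≡0⇒c≢M , c≡0⇒a≢M)
  rewrite ≢⇒≡ᵇ-false a≢c | ≢⇒≡ᵇ-false a+1≢c | ≢⇒≡ᵇ-false c+1≢a
        | no-wrap M a c a≡0⇒c≢M | no-wrap M c a c≡0⇒a≢M = refl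

-- Position 0 serves unless the edge meets positions 0, 1 or M, which get explicit witnesses.
far-position : ∀ k a b → b ℕ.≤ 4 ℕ.+ k → RimStep (4 ℕ.+ k) a b →
  Σ[ c ∈ ℕ ] c ℕ.≤ 4 ℕ.+ k × NotNear (4 ℕ.+ k) a c × NotNear (4 ℕ.+ k) b c
far-position k _ _ _ (inj₂ (refl , refl)) = 2 , s≤s (s≤s z≤n) ,
  ((λ ()) , (λ ()) , (λ ()) , (λ _ ()) , (λ ())) , ((λ ()) , (λ ()) , (λ ()) , (λ ()) , (λ ()))
far-position k 0 _ _ (inj₁ refl) = 3 , s≤s (s≤s (s≤s z≤n)) ,
  ((λ ()) , (λ ()) , (λ ()) , (λ _ ()) , (λ ())) , ((λ ()) , (λ ()) , (λ ()) , (λ ()) , (λ ()))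
far-position k 1 _ _ (inj₁ refl) = 4 , s≤s (s≤s (s≤s (s≤s z≤n))) ,
  ((λ ()) , (λ ()) , (λ ()) , (λ ()) , (λ ())) , ((λ ()) , (λ ()) , (λ ()) , (λ ()) , (λ ()))
far-position k (suc (suc a)) _ a+3≤M (inj₁ refl) with 3 ℕ.+ a ℕ.≟ 4 ℕ.+ k
... | yes refl = 1 , s≤s z≤n ,
  ((λ ()) , (λ ()) , (λ ()) , (λ ()) , (λ ())) , ((λ ()) , (λ ()) , (λ ()) , (λ ()) , (λ ()))
... | no a+3≢M = 0 , z≤n ,
  ((λ ()) , (λ ()) , (λ ()) , (λ ()) , (λ _ a+2≡M → ℕP.<-irrefl a+2≡M a+3≤M)) ,
  ((λ ()) , (λ ()) , (λ ()) , (λ ()) , (λ _ → a+3≢M))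

rimHalf : ∀ {m} → Fin (suc m) → ℚ
rimHalf zero    = 0ℚ
rimHalf (suc _) = ½

rimHalf-bounds : ∀ {m} (v : Fin (suc m)) → 0ℚ ≤ rimHalf v × rimHalf v ≤ 1ℚ
rimHalf-bounds zero    = ≤-refl , from-yes (0ℚ ≤? 1ℚ)
rimHalf-bounds (suc _) = 0≤½ , ½≤1

far-rim-position : ∀ k a b → a ℕ.≤ 4 ℕ.+ k → b ℕ.≤ 4 ℕ.+ k → RimStep (4 ℕ.+ k) a b ⊎ RimStep (4 ℕ.+ k) b a →
  Σ[ c ∈ Fin (5 ℕ.+ k) ] NotNear (4 ℕ.+ k) a (toℕ c) × NotNear (4 ℕ.+ k) b (toℕ c)
far-rim-position k a b a≤M b≤M step = as-Fin (oriented step)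
  where
  oriented : RimStep (4 ℕ.+ k) a b ⊎ RimStep (4 ℕ.+ k) b a →
    Σ[ c ∈ ℕ ] c ℕ.≤ 4 ℕ.+ k × NotNear (4 ℕ.+ k) a c × NotNear (4 ℕ.+ k) b c
  oriented (inj₁ a→b) = far-position k a b b≤M a→b
  oriented (inj₂ b→a) with far-position k b a a≤M b→a
  ... | c , c≤M , b≁c , a≁c = c , c≤M , a≁c , b≁c
  as-Fin : Σ[ c ∈ ℕ ] c ℕ.≤ 4 ℕ.+ k × NotNear (4 ℕ.+ k) a c × NotNear (4 ℕ.+ k) b c →
    Σ[ c ∈ Fin (5 ℕ.+ k) ] NotNear (4 ℕ.+ k) a (toℕ c) × NotNear (4 ℕ.+ k) b (toℕ c)
  as-Fin (c , c≤M , a≁c , b≁c) =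
    fromℕ< (s≤s c≤M) , subst (NotNear _ a) (sym toℕ-c) a≁c , subst (NotNear _ b) (sym toℕ-c) b≁c
    where
    toℕ-c : toℕ (fromℕ< (s≤s c≤M)) ≡ c
    toℕ-c = toℕ-fromℕ< (s≤s c≤M)

module LargeWheel (j : ℕ) where
  open Wheel (2 ℕ.+ j) public
  open Graph W using (adj)

  rim-far-from : ∀ x c → NotNear (4 ℕ.+ j) (toℕ x) (toℕ c) → suc c ≢ suc x × dist W (suc x) (suc c) ≡ 2
  rim-far-from x c x≁c = x≢c ∘ sym , dist-nonadjacent x≢c (notNear⇒nonadjacent (4 ℕ.+ j) (toℕ x) (toℕ c) x≁c)
    where
    x≢c : suc x ≢ suc c
    x≢c x≡c = proj₁ x≁c (cong toℕ (suc-injective x≡c))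

  far-rim-vertex : ∀ r s (r~s : T (adj (suc r) (suc s))) →
    Σ[ c ∈ Fin (5 ℕ.+ j) ] suc c ∉ₑ (suc r , suc s , r~s) × distEdge W (suc r , suc s , r~s) (suc c) ≡ 2
  far-rim-vertex r s r~s = from-position (far-rim-position j (toℕ r) (toℕ s)
    (ℕP.≤-pred (toℕ<n r)) (ℕP.≤-pred (toℕ<n s)) (rim-adjacent⇒step (4 ℕ.+ j) (toℕ r) (toℕ s) r~s))
    where
    from-position : Σ[ c ∈ Fin (5 ℕ.+ j) ] NotNear (4 ℕ.+ j) (toℕ r) (toℕ c) × NotNear (4 ℕ.+ j) (toℕ s) (toℕ c) →
      Σ[ c ∈ Fin (5 ℕ.+ j) ] suc c ∉ₑ (suc r , suc s , r~s) × distEdge W (suc r , suc s , r~s) (suc c) ≡ 2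
    from-position (c , r≁c , s≁c) =
      c , [ proj₁ (rim-far-from r c r≁c) , proj₁ (rim-far-from s c s≁c) ] ,
      cong₂ _⊓_ (proj₂ (rim-far-from r c r≁c)) (proj₂ (rim-far-from s c s≁c))

  RimResolvers : Edge W → Edge W → Set
  RimResolvers e₁ e₂ = Σ[ a ∈ Fin (5 ℕ.+ j) ] Σ[ b ∈ Fin (5 ℕ.+ j) ]
    a ≢ b × Resolves e₁ e₂ (suc a) × Resolves e₁ e₂ (suc b)

  rimResolvers-sym : ∀ {e₁ e₂} → RimResolvers e₁ e₂ → RimResolvers e₂ e₁
  rimResolvers-sym (a , b , a≢b , res-a , res-b) = a , b , a≢b , ≢-sym res-a , ≢-sym res-b

  hub-private⇒rimResolvers : ∀ e₁ e₂ → hub ∈ₑ e₁ → hub ∉ₑ e₂ → ∀ w → w ∈ₑ e₂ → w ∉ₑ e₁ → RimResolvers e₁ e₂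
  hub-private⇒rimResolvers _ _ _ hub∉e₂ zero hub∈e₂ _ = contradiction hub∈e₂ hub∉e₂
  hub-private⇒rimResolvers _ (zero , _ , _) _ hub∉e₂ (suc _) _ _ = contradiction (inj₁ refl) hub∉e₂
  hub-private⇒rimResolvers _ (suc _ , zero , _) _ hub∉e₂ (suc _) _ _ = contradiction (inj₂ refl) hub∉e₂
  hub-private⇒rimResolvers e₁ (suc r , suc s , r~s) hub∈e₁ hub∉e₂ (suc a) a∈e₂ a∉e₁ =
    from-far (far-rim-vertex r s r~s)
    where
    e₂ = (suc r , suc s , r~s)
    from-far : Σ[ c ∈ Fin (5 ℕ.+ j) ] suc c ∉ₑ e₂ × distEdge W e₂ (suc c) ≡ 2 → RimResolvers e₁ e₂
    from-far (c , c∉e₂ , far) =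
      a , c , (λ { refl → c∉e₂ a∈e₂ }) ,
      ≢-sym (resolves-private {e₂} {e₁} a∈e₂ a∉e₁) ,
      λ eq → contradiction (subst (ℕ._≤ 1) (trans eq far) (distEdge-≤1 {e₁} (suc c) hub∈e₁)) λ { (s≤s ()) }

  rimHalf-resolving : IsEdgeResolvingFunction W rimHalf
  rimHalf-resolving = rimHalf-bounds , resolving-by-private-endpoints rimHalf bound
    where
    weight-≥1 : ∀ {e₁ e₂} → RimResolvers e₁ e₂ → 1ℚ ≤ weightR W rimHalf e₁ e₂
    weight-≥1 {e₁} {e₂} (a , b , a≢b , res-a , res-b) =
      ½-resolvers⇒1≤weightR rimHalf e₁ e₂ {suc a} {suc b} (a≢b ∘ suc-injective) (proj₁ ∘ rimHalf-bounds) refl refl res-a res-b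
    bound : ∀ e₁ e₂ u w → PrivateEndpoints e₁ e₂ u w → 1ℚ ≤ weightR W rimHalf e₁ e₂
    bound e₁ e₂ zero w (hub∈e₁ , hub∉e₂ , w∈e₂ , w∉e₁) =
      weight-≥1 {e₁} {e₂} (hub-private⇒rimResolvers e₁ e₂ hub∈e₁ hub∉e₂ w w∈e₂ w∉e₁)
    bound e₁ e₂ (suc u) zero (u∈e₁ , u∉e₂ , hub∈e₂ , hub∉e₁) =
      weight-≥1 {e₁} {e₂} (rimResolvers-sym {e₂} {e₁} (hub-private⇒rimResolvers e₂ e₁ hub∈e₂ hub∉e₁ (suc u) u∈e₁ u∉e₂))
    bound e₁ e₂ (suc u) (suc w) (u∈e₁ , u∉e₂ , w∈e₂ , w∉e₁) =
      weight-≥1 {e₁} {e₂} (u , w , (λ { refl → w∉e₁ u∈e₁ }) ,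
        resolves-private {e₁} {e₂} u∈e₁ u∉e₂ , ≢-sym (resolves-private {e₂} {e₁} w∈e₂ w∉e₁))

  sumFin-rimHalf : sumFin W (rimHalf {5 ℕ.+ j}) ≡ (+ (5 ℕ.+ j)) / 2
  sumFin-rimHalf = trans (+-identityˡ (sumFin W {5 ℕ.+ j} (λ _ → ½))) (sumFin-½ (5 ℕ.+ j))

small-wheel : ∀ k → k ℕ.≤ 1 → IsFractionalEdgeMetricDimension (wheel (4 ℕ.+ k)) ((+ (4 ℕ.+ k)) / 2)
small-wheel k k≤1 = ((λ _ → ½) , uniform-½-resolving , sumFin-½ (4 ℕ.+ k)) , minimal
  where
  open Wheel k
  minimal : ∀ g → IsEdgeResolvingFunction W g → (+ (4 ℕ.+ k)) / 2 ≤ sumFin W g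
  minimal g ρ = subst (_≤ sumFin W g) (sumFin-½ (4 ℕ.+ k))
    (full-½-bound {g} ρ (proj₁ hub-pairs) (proj₂ hub-pairs))
    where hub-pairs = small-wheel-hub-pairs k k≤1 {g} ρ

large-wheel : ∀ j → IsFractionalEdgeMetricDimension (wheel (6 ℕ.+ j)) ((+ (5 ℕ.+ j)) / 2)
large-wheel j = (rimHalf , rimHalf-resolving , sumFin-rimHalf) , minimal
  where
  open LargeWheel j
  minimal : ∀ g → IsEdgeResolvingFunction W g → (+ (5 ℕ.+ j)) / 2 ≤ sumFin W g
  minimal g ρ = subst (_≤ sumFin W g) (sumFin-½ (5 ℕ.+ j)) (rim-½-bound {g} ρ)

mainTheorem13 : (n : ℕ) → 4 ℕ.≤ n →
    ((n ≡ 4 ⊎ n ≡ 5) → IsFractionalEdgeMetricDimension (wheel n) ((+ n) / 2)) ×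
    (6 ℕ.≤ n → IsFractionalEdgeMetricDimension (wheel n) ((+ (n ℕ.∸ 1)) / 2))
mainTheorem13 n _ = small , large
  where
  small : (n ≡ 4 ⊎ n ≡ 5) → IsFractionalEdgeMetricDimension (wheel n) ((+ n) / 2)
  small (inj₁ refl) = small-wheel 0 z≤n
  small (inj₂ refl) = small-wheel 1 (s≤s z≤n)
  large : 6 ℕ.≤ n → IsFractionalEdgeMetricDimension (wheel n) ((+ (n ∸ 1)) / 2)
  large (s≤s (s≤s (s≤s (s≤s (s≤s (s≤s {n = j} z≤n)))))) = large-wheel j
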